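{- Let $B$ be a proper board of size $2n+1$ and let $H$ be any Hamiltonian cycle of the board graph $G_B$. Then any configuration of $n$ gourds on $B$ can be transformed, using $O(n^2)$ moves, into a configuration in which every gourd occupies two cells that are consecutive on $H$ (i.e., every gourd is aligned with an edge of $H$).
   Context: A board is a finite, connected set of cells of the regular hexagonal tiling of the plane; two cells are adjacent if they share a side. The board graph $G_B$ has the cells as vertices, with edges between adjacent cells. A board is proper if all of the following hold: - it has $2n+1$ cells; - it is hole-free (the complement of the union of its cells is connected); - $G_B$ is 2-connected; - it is not the Star of David board: the 13-cell board consisting of a central cell, its 6 neighbors, and the 6 further cells each adjacent to two consecutive neighbors of the central cell. A gourd is a piece covering two adjacent cells, with two distinguishable ends. A configuration of $n$ gourds is a placement on pairwise disjoint pairs of adjacent cells, leaving one empty cell $e$. Suppose a gourd has ends $a$ on cell $p$ and $b$ on cell $q$. A move is one of: - Slide: $p,q,e$ are consecutive along a straight grid line. The gourd moves to $a$ on $q$, $b$ on $e$. - Turn: $q$ is adjacent to $p$ and $e$, with a $120^\circ$ angle at $q$ between the centers. The gourd moves to $a$ on $q$, $b$ on $e$. - Pivot: $e$ is adjacent to both $p$ and $q$. One end stays fixed and the other moves to $e$. -}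

module Defs where

open import Data.Nat using (ℕ; zero; suc; _+_; _*_; _≤_)
open import Data.Integer as ℤ using (ℤ; +_; -[1+_])
open import Data.Product using (Σ; _×_; _,_; proj₁; proj₂; ∃)
open import Data.Sum using (_⊎_)
open import Data.Fin using (Fin; zero; suc)
open import Data.Vec as V using (Vec; _[_]≔_; lookup)
open import Data.List as L using (List; []; _∷_; _++_; length; zip; concatMap)
open import Data.List.Membership.Propositional using (_∈_; _∉_)
open import Data.List.Relation.Unary.All using (All)
open import Data.List.Relation.Unary.Unique.Propositional using (Unique)
open import Data.List.Relation.Binary.Permutation.Propositional using (_↭_)
open import Relation.Binary.PropositionalEquality using (_≡_; _≢_)
open import Relation.Nullary using (¬_)

-- Cells of the hexagonal tiling, in axial coordinates.

Cell : Set
Cell = ℤ × ℤ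

_⊕_ : Cell → Cell → Cell
(a , b) ⊕ (c , d) = (a ℤ.+ c , b ℤ.+ d)

-- The six directions, in counter-clockwise cyclic order.
Dir : Set
Dir = Fin 6

dvec : Dir → Cell
dvec zero                               = (+ 1 , + 0)
dvec (suc zero)                         = (+ 0 , + 1)
dvec (suc (suc zero))                   = (-[1+ 0 ] , + 1)
dvec (suc (suc (suc zero)))             = (-[1+ 0 ] , + 0)
dvec (suc (suc (suc (suc zero))))       = (+ 0 , -[1+ 0 ])
dvec (suc (suc (suc (suc (suc zero))))) = (+ 1 , -[1+ 0 ])

rotL : Dir → Dir
rotL zero                               = suc zero
rotL (suc zero)                         = suc (suc zero)
rotL (suc (suc zero))                   = suc (suc (suc zero))
rotL (suc (suc (suc zero)))             = suc (suc (suc (suc zero)))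
rotL (suc (suc (suc (suc zero))))       = suc (suc (suc (suc (suc zero))))
rotL (suc (suc (suc (suc (suc zero))))) = zero

rotR : Dir → Dir
rotR zero                               = suc (suc (suc (suc (suc zero))))
rotR (suc zero)                         = zero
rotR (suc (suc zero))                   = suc zero
rotR (suc (suc (suc zero)))             = suc (suc zero)
rotR (suc (suc (suc (suc zero))))       = suc (suc (suc zero))
rotR (suc (suc (suc (suc (suc zero))))) = suc (suc (suc (suc zero)))

Adj : Cell → Cell → Set
Adj x y = Σ Dir λ d → y ≡ x ⊕ dvec d

data Walk (P : Cell → Set) : Cell → Cell → Set where
  stop : ∀ {x} → P x → Walk P x x
  step : ∀ {x y z} → P x → Adj x y → Walk P y z → Walk P x z

Connected : (Cell → Set) → Set
Connected P = ∀ x y → P x → P y → Walk P x y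

Board : Set
Board = List Cell

InB : Board → Cell → Set
InB B c = c ∈ B

HoleFree : Board → Set
HoleFree B = Connected (λ c → c ∉ B)

TwoConnected : Board → Set
TwoConnected B =
  (3 ≤ length B) × Connected (InB B) ×
  (∀ v → v ∈ B → Connected (λ c → (c ∈ B) × (c ≢ v)))

starCells : Cell → List Cell
starCells c = c ∷ concatMap (λ d → (c ⊕ dvec d) ∷ ((c ⊕ dvec d) ⊕ dvec (rotL d)) ∷ [])
                    (L.allFin 6)

IsStarOfDavid : Board → Set
IsStarOfDavid B = Σ Cell λ c → ∀ x → (x ∈ B → x ∈ starCells c) × (x ∈ starCells c → x ∈ B)

Proper : ℕ → Board → Set
Proper n B =
  Unique B × (length B ≡ suc (2 * n)) × Connected (InB B) ×
  HoleFree B × TwoConnected B × ¬ IsStarOfDavid B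

cycEdges : List Cell → List (Cell × Cell)
cycEdges []       = []
cycEdges (x ∷ xs) = zip (x ∷ xs) (xs ++ (x ∷ []))

HamiltonianCycle : Board → List Cell → Set
HamiltonianCycle B H = (H ↭ B) × All (λ e → Adj (proj₁ e) (proj₂ e)) (cycEdges H)

ConsecutiveOn : List Cell → Cell → Cell → Set
ConsecutiveOn H x y = ((x , y) ∈ cycEdges H) ⊎ ((y , x) ∈ cycEdges H)

-- Configurations of n gourds. A gourd is a pair (cell of end a , cell of end b).

record Config (n : ℕ) : Set where
  constructor conf
  field
    gourds : Vec (Cell × Cell) n
    empty  : Cell
open Config public

occupied : ∀ {n} → Config n → List Cell
occupied c = concatMap (λ g → proj₁ g ∷ proj₂ g ∷ []) (V.toList (gourds c)) ++ (empty c ∷ [])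

ValidConfig : ∀ {n} → Board → Config n → Set
ValidConfig B c =
  All (λ g → Adj (proj₁ g) (proj₂ g)) (V.toList (gourds c)) ×
  All (InB B) (occupied c) × Unique (occupied c)

-- p, q, e consecutive on a straight line (d' = d: slide) or with a
-- 120° angle at q (d' = d rotated by ±60°: turn)
SlideOrTurn : Cell → Cell → Cell → Set
SlideOrTurn p q e = Σ Dir λ d → Σ Dir λ d' →
  (q ≡ p ⊕ dvec d) × (e ≡ q ⊕ dvec d') × (d' ≡ d ⊎ d' ≡ rotL d ⊎ d' ≡ rotR d)

data Move {n : ℕ} : Config n → Config n → Set where
  stA : ∀ {gs e} (i : Fin n) {x y} → lookup gs i ≡ (x , y) → SlideOrTurn x y e →
        Move (conf gs e) (conf (gs [ i ]≔ (y , e)) x)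
  stB : ∀ {gs e} (i : Fin n) {x y} → lookup gs i ≡ (x , y) → SlideOrTurn y x e →
        Move (conf gs e) (conf (gs [ i ]≔ (e , x)) y)
  pvA : ∀ {gs e} (i : Fin n) {x y} → lookup gs i ≡ (x , y) → Adj e x → Adj e y →
        Move (conf gs e) (conf (gs [ i ]≔ (x , e)) y)
  pvB : ∀ {gs e} (i : Fin n) {x y} → lookup gs i ≡ (x , y) → Adj e x → Adj e y →
        Move (conf gs e) (conf (gs [ i ]≔ (e , y)) x)

data Moves {n : ℕ} : ℕ → Config n → Config n → Set where
  done : ∀ {c} → Moves zero c c
  _∷ₘ_ : ∀ {k c c' c''} → Move c c' → Moves k c' c'' → Moves (suc k) c c''

AlignedWith : ∀ {n} → List Cell → Config n → Set
AlignedWith H c = All (λ g → ConsecutiveOn H (proj₁ g) (proj₂ g)) (V.toList (gourds c))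

module Submission where

-- Let next be the successor map of the Hamiltonian cycle H and e the empty cell. The gourd
-- covering next e can always be moved onto the cycle edge (e , next e) by a slide, a turn or a
-- pivot, emptying its other cell g. If that gourd was misaligned, one fewer gourd is misaligned;
-- otherwise g = next (next e), so the empty cell has advanced two steps along H. Walking the empty
-- cell towards a misaligned gourd therefore aligns it within 2|H| moves, and aligning all of the at
-- most n misaligned gourds takes at most n · 2(2n + 1) ≤ 6n² moves.

open import Defs
open import Algebra.Bundles using (AbelianGroup)
import Algebra.Properties.Group as GroupProperties
open import Data.Bool using (if_then_else_)
open import Data.Empty using (⊥-elim)
open import Data.Fin using (Fin; zero; suc)
open import Data.Integer as ℤ using (+_)
import Data.Integer.Properties as ℤ
open import Data.List using (List; []; _∷_; _++_; length; zip; map; concatMap)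
open import Data.List.Properties using (length-++)
open import Data.List.Membership.Propositional using (_∈_)
open import Data.List.Membership.Propositional.Properties
  using (∈-∃++; ∈-map⁺; ∈-++⁺ˡ; ∈-++⁺ʳ; ∈-++⁻)
open import Data.List.Relation.Binary.Permutation.Propositional
  using (_↭_; ↭-refl; ↭-prep; ↭-swap; ↭-trans; ↭-sym; ↭⇒↭ₛ; module PermutationReasoning)
open import Data.List.Relation.Binary.Permutation.Propositional.Properties
  using (↭-length; shift; ∈-resp-↭; ∷↭∷ʳ; ++⁺ʳ; All-resp-↭)
open import Data.List.Relation.Binary.Subset.Propositional using (_⊆_)
open import Data.List.Relation.Unary.All as All using (All; []; _∷_)
open import Data.List.Relation.Unary.AllPairs using (_∷_)
open import Data.List.Relation.Unary.Any using (here; there)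
open import Data.List.Relation.Unary.Unique.Propositional using (Unique)
open import Data.List.Relation.Unary.Unique.Propositional.Properties using (Unique[x∷xs]⇒x∉xs)
open import Data.Nat using (ℕ; zero; suc; _+_; _*_; _≤_; _<_; z≤n; s≤s)
open import Data.Nat.GeneralisedArithmetic using (iterate)
open import Data.Nat.Properties
  using (≤-refl; ≤-reflexive; ≤-trans; <-irrefl; m≤n⇒m≤1+n; +-mono-≤; +-monoˡ-≤;
         *-monoˡ-≤; *-monoʳ-≤; m≤m*n; *-suc; +-comm; suc-injective; 0≢1+n; module ≤-Reasoning)
open import Data.Nat.Tactic.RingSolver using (solve-∀)
open import Data.Product using (Σ; _×_; _,_; proj₁; proj₂)
open import Data.Product.Properties using (≡-dec)
open import Data.Sum using (_⊎_; inj₁; inj₂)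
open import Data.Vec using (Vec; []; _∷_; lookup; _[_]≔_; toList; count)
open import Data.Vec.Properties using (lookup∘update′; count≤n)
open import Data.Vec.Relation.Unary.All.Properties using (lookup⁺; toList⁻)
open import Function using (_∘_)
open import Relation.Binary.Definitions using (DecidableEquality)
open import Relation.Binary.PropositionalEquality
  using (_≡_; _≢_; refl; sym; trans; cong; cong₂; subst; setoid)
open import Relation.Nullary using (¬_; yes; no; does)
open import Relation.Nullary.Decidable using (_⊎-dec_; decidable-stable)
open import Relation.Unary using (Decidable; ∁)
open import Relation.Unary.Properties using (∁?)

pattern d0 = zero
pattern d1 = suc zero
pattern d2 = suc (suc zero)
pattern d3 = suc (suc (suc zero))
pattern d4 = suc (suc (suc (suc zero)))
pattern d5 = suc (suc (suc (suc (suc zero))))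

O : Cell
O = (+ 0 , + 0)

⊕-assoc : ∀ x u v → (x ⊕ u) ⊕ v ≡ x ⊕ (u ⊕ v)
⊕-assoc (a , b) (c , d) (e , f) = cong₂ _,_ (ℤ.+-assoc a c e) (ℤ.+-assoc b d f)

⊕-identityʳ : ∀ x → x ⊕ O ≡ x
⊕-identityʳ (a , b) = cong₂ _,_ (ℤ.+-identityʳ a) (ℤ.+-identityʳ b)

⊕-identityʳ-unique : ∀ x v → x ⊕ v ≡ x → v ≡ O
⊕-identityʳ-unique (a , b) (c , d) eq =
  cong₂ _,_ (identityʳ-unique a c (cong proj₁ eq)) (identityʳ-unique b d (cong proj₂ eq))
  where open GroupProperties (AbelianGroup.group ℤ.+-0-abelianGroup) using (identityʳ-unique)

⊕-cancel : ∀ x u v → u ⊕ v ≡ O → (x ⊕ u) ⊕ v ≡ x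
⊕-cancel x u v u+v≡O = trans (⊕-assoc x u v) (trans (cong (x ⊕_) u+v≡O) (⊕-identityʳ x))

opp : Dir → Dir
opp d0 = d3
opp d1 = d4
opp d2 = d5
opp d3 = d0
opp d4 = d1
opp d5 = d2

dvec-opp : ∀ d → dvec d ⊕ dvec (opp d) ≡ O
dvec-opp d0 = refl
dvec-opp d1 = refl
dvec-opp d2 = refl
dvec-opp d3 = refl
dvec-opp d4 = refl
dvec-opp d5 = refl

dvec-rotL² : ∀ d → dvec d ⊕ dvec (rotL (rotL d)) ≡ dvec (rotL d)
dvec-rotL² d0 = refl
dvec-rotL² d1 = refl
dvec-rotL² d2 = refl
dvec-rotL² d3 = refl
dvec-rotL² d4 = refl
dvec-rotL² d5 = refl

dvec-rotR² : ∀ d → dvec d ⊕ dvec (rotR (rotR d)) ≡ dvec (rotR d)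
dvec-rotR² d0 = refl
dvec-rotR² d1 = refl
dvec-rotR² d2 = refl
dvec-rotR² d3 = refl
dvec-rotR² d4 = refl
dvec-rotR² d5 = refl

dvec≢O : ∀ d → dvec d ≢ O
dvec≢O d0 ()
dvec≢O d1 ()
dvec≢O d2 ()
dvec≢O d3 ()
dvec≢O d4 ()
dvec≢O d5 ()

Adj-sym : ∀ {x y} → Adj x y → Adj y x
Adj-sym {x} (d , refl) = opp d , sym (⊕-cancel x (dvec d) (dvec (opp d)) (dvec-opp d))

Adj-irrefl : ∀ {x} → ¬ Adj x x
Adj-irrefl {x} (d , x≡x+d) = dvec≢O d (⊕-identityʳ-unique x (dvec d) (sym x≡x+d))

data Relative (d : Dir) : Dir → Set where
  ahead      : Relative d d
  left       : Relative d (rotL d)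
  right      : Relative d (rotR d)
  back       : Relative d (opp d)
  sharpLeft  : Relative d (rotL (rotL d))
  sharpRight : Relative d (rotR (rotR d))

relative : ∀ d d' → Relative d d'
relative d0 d0 = ahead
relative d0 d1 = left
relative d0 d2 = sharpLeft
relative d0 d3 = back
relative d0 d4 = sharpRight
relative d0 d5 = right
relative d1 d0 = right
relative d1 d1 = ahead
relative d1 d2 = left
relative d1 d3 = sharpLeft
relative d1 d4 = back
relative d1 d5 = sharpRight
relative d2 d0 = sharpRight
relative d2 d1 = right
relative d2 d2 = ahead
relative d2 d3 = left
relative d2 d4 = sharpLeft
relative d2 d5 = back
relative d3 d0 = back
relative d3 d1 = sharpRight
relative d3 d2 = right
relative d3 d3 = ahead
relative d3 d4 = left
relative d3 d5 = sharpLeft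
relative d4 d0 = sharpLeft
relative d4 d1 = back
relative d4 d2 = sharpRight
relative d4 d3 = right
relative d4 d4 = ahead
relative d4 d5 = left
relative d5 d0 = left
relative d5 d1 = sharpLeft
relative d5 d2 = back
relative d5 d3 = sharpRight
relative d5 d4 = right
relative d5 d5 = ahead

-- A path g, f, e of three distinct cells is straight or bent by 120° at f,
-- unless its ends are adjacent (a 60° bend).
slideTurnOrPivot : ∀ {g f e} → Adj g f → Adj f e → g ≢ e → SlideOrTurn g f e ⊎ (Adj e g × Adj e f)
slideTurnOrPivot {g} (d , refl) (d' , refl) g≢e with relative d d'
... | ahead      = inj₁ (d , d , refl , refl , inj₁ refl)
... | left       = inj₁ (d , rotL d , refl , refl , inj₂ (inj₁ refl))
... | right      = inj₁ (d , rotR d , refl , refl , inj₂ (inj₂ refl))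
... | back       = ⊥-elim (g≢e (sym (⊕-cancel g (dvec d) (dvec (opp d)) (dvec-opp d))))
... | sharpLeft  = inj₂ (Adj-sym (rotL d , trans (⊕-assoc g _ _) (cong (g ⊕_) (dvec-rotL² d))) ,
                         Adj-sym (rotL (rotL d) , refl))
... | sharpRight = inj₂ (Adj-sym (rotR d , trans (⊕-assoc g _ _) (cong (g ⊕_) (dvec-rotR² d))) ,
                         Adj-sym (rotR (rotR d) , refl))

module _ {A : Set} where

  unique-resp-↭ : ∀ {xs ys : List A} → xs ↭ ys → Unique xs → Unique ys
  unique-resp-↭ p = Unique-resp-↭ (↭⇒↭ₛ p)
    where open import Data.List.Relation.Binary.Permutation.Setoid.Properties (setoid A)
            using (Unique-resp-↭)

  unique-⊆⇒length-≤ : ∀ {xs ys : List A} → Unique xs → xs ⊆ ys → length xs ≤ length ys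
  unique-⊆⇒length-≤ {[]}     _           _     = z≤n
  unique-⊆⇒length-≤ {x ∷ xs} (x∉xs ∷ u) xs⊆ys with ∈-∃++ (xs⊆ys (here refl))
  ... | p , q , refl =
    subst (suc (length xs) ≤_) (sym (↭-length (shift x p q)))
          (s≤s (unique-⊆⇒length-≤ u xs⊆p++q))
    where
    xs⊆p++q : xs ⊆ p ++ q
    xs⊆p++q z∈xs with ∈-resp-↭ (shift x p q) (xs⊆ys (there z∈xs))
    ... | here refl = ⊥-elim (All.lookup x∉xs z∈xs refl)
    ... | there z∈p++q = z∈p++q

  module _ (_≟_ : DecidableEquality A) where
    open import Data.List.Membership.DecPropositional _≟_ using (_∈?_)

    unique-⊆-length⇒⊇ : ∀ {xs ys : List A} →
      Unique xs → xs ⊆ ys → length ys ≤ length xs → ys ⊆ xs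
    unique-⊆-length⇒⊇ {xs} {ys} u xs⊆ys ys≤xs {z} z∈ys with z ∈? xs
    ... | yes z∈xs = z∈xs
    ... | no  z∉xs = ⊥-elim (<-irrefl refl (≤-trans longer ys≤xs))
      where
      longer : suc (length xs) ≤ length ys
      longer = unique-⊆⇒length-≤ (All.tabulate (λ m z≡ → z∉xs (subst (_∈ xs) (sym z≡) m)) ∷ u)
                 λ { (here refl) → z∈ys ; (there m) → xs⊆ys m }

  ∈-unique-map-injective : ∀ {B : Set} {f : A → B} {xs x x'} → Unique (map f xs) →
    x ∈ xs → x' ∈ xs → f x ≡ f x' → x ≡ x'
  ∈-unique-map-injective _          (here refl) (here refl) _  = refl
  ∈-unique-map-injective {f = f} (fx∉ ∷ _) (here refl) (there m') eq =
    ⊥-elim (All.lookup fx∉ (∈-map⁺ f m') eq)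
  ∈-unique-map-injective {f = f} (fx∉ ∷ _) (there m) (here refl) eq =
    ⊥-elim (All.lookup fx∉ (∈-map⁺ f m) (sym eq))
  ∈-unique-map-injective (_ ∷ u) (there m) (there m') eq = ∈-unique-map-injective u m m' eq

  chain : A → List A → List (A × A)
  chain h []          = []
  chain h (a ∷ [])    = (a , h) ∷ []
  chain h (a ∷ b ∷ r) = (a , b) ∷ chain h (b ∷ r)

  zip≡chain : ∀ h a as → zip (a ∷ as) (as ++ h ∷ []) ≡ chain h (a ∷ as)
  zip≡chain h a []       = refl
  zip≡chain h a (b ∷ bs) = cong ((a , b) ∷_) (zip≡chain h b bs)

  map-proj₁-chain : ∀ h xs → map proj₁ (chain h xs) ≡ xs
  map-proj₁-chain h []          = refl
  map-proj₁-chain h (a ∷ [])    = refl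
  map-proj₁-chain h (a ∷ b ∷ r) = cong (a ∷_) (map-proj₁-chain h (b ∷ r))

  map-proj₂-chain : ∀ h a as → map proj₂ (chain h (a ∷ as)) ≡ as ++ h ∷ []
  map-proj₂-chain h a []       = refl
  map-proj₂-chain h a (b ∷ bs) = cong (b ∷_) (map-proj₂-chain h b bs)

  chain-⊆-∷ : ∀ h x xs → chain h xs ⊆ chain h (x ∷ xs)
  chain-⊆-∷ h x (_ ∷ _) = there

  chain-suffix : ∀ h {a xs} → a ∈ xs →
    Σ (List A) λ s → chain h (a ∷ s) ⊆ chain h xs × length s < length xs
  chain-suffix h {xs = _ ∷ xs} (here refl) = xs , (λ m → m) , ≤-refl
  chain-suffix h {xs = x ∷ xs} (there a∈xs) with chain-suffix h a∈xs
  ... | s , sub , s<xs = s , (λ m → chain-⊆-∷ h x xs (sub m)) , m≤n⇒m≤1+n s<xs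

module _ {A : Set} (_≟_ : DecidableEquality A) where

  -- the partner of a in an association list, a itself if there is none
  assoc : List (A × A) → A → A
  assoc []             a = a
  assoc ((b , c) ∷ ps) a = if does (b ≟ a) then c else assoc ps a

  assoc-∈ : ∀ {ps a} → a ∈ map proj₁ ps → (a , assoc ps a) ∈ ps
  assoc-∈ {(b , c) ∷ ps} {a} a∈ with b ≟ a | a∈
  ... | yes refl | _          = here refl
  ... | no  b≢a  | here a≡b   = ⊥-elim (b≢a (sym a≡b))
  ... | no  _    | there a∈ps = there (assoc-∈ a∈ps)

  assoc-unique : ∀ {ps a b} → Unique (map proj₁ ps) → (a , b) ∈ ps → assoc ps a ≡ b
  assoc-unique u ab∈ =
    cong proj₂ (∈-unique-map-injective u (assoc-∈ (∈-map⁺ proj₁ ab∈)) ab∈ refl)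

_≟_ : DecidableEquality Cell
_≟_ = ≡-dec ℤ._≟_ ℤ._≟_

iterate-+ : ∀ {A : Set} (f : A → A) x m n → iterate f x (m + n) ≡ iterate f (iterate f x m) n
iterate-+ f x zero    n = refl
iterate-+ f x (suc m) n = iterate-+ f (f x) m n

module CyclicSuccessor (y : Cell) (ys : List Cell) (H-unique : Unique (y ∷ ys)) where

  H : List Cell
  H = y ∷ ys

  E : List (Cell × Cell)
  E = cycEdges H

  next : Cell → Cell
  next = assoc _≟_ E

  chain⊆E : chain y H ⊆ E
  chain⊆E = subst (_ ∈_) (sym (zip≡chain y y ys))

  map-proj₁-E : map proj₁ E ≡ H
  map-proj₁-E = trans (cong (map proj₁) (zip≡chain y y ys)) (map-proj₁-chain y H)

  map-proj₂-E : map proj₂ E ≡ ys ++ y ∷ []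
  map-proj₂-E = trans (cong (map proj₂) (zip≡chain y y ys)) (map-proj₂-chain y y ys)

  edge-next : ∀ {a b} → (a , b) ∈ E → next a ≡ b
  edge-next = assoc-unique _≟_ (subst Unique (sym map-proj₁-E) H-unique)

  next-edge : ∀ {a} → a ∈ H → (a , next a) ∈ E
  next-edge a∈H = assoc-∈ _≟_ (subst (_ ∈_) (sym map-proj₁-E) a∈H)

  next-∈ : ∀ {a} → a ∈ H → next a ∈ H
  next-∈ {a} a∈H =
    ∈-resp-↭ (↭-sym (∷↭∷ʳ y ys)) (subst (next a ∈_) map-proj₂-E (∈-map⁺ proj₂ (next-edge a∈H)))

  edge-injectiveˡ : ∀ {a a' b} → (a , b) ∈ E → (a' , b) ∈ E → a ≡ a'
  edge-injectiveˡ ab∈ a'b∈ = cong proj₁ (∈-unique-map-injective unique₂ ab∈ a'b∈ refl)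
    where
    unique₂ : Unique (map proj₂ E)
    unique₂ = subst Unique (sym map-proj₂-E) (unique-resp-↭ (∷↭∷ʳ y ys) H-unique)

  walk-to-head : ∀ a s → chain y (a ∷ s) ⊆ E → iterate next a (suc (length s)) ≡ y
  walk-to-head a []      sub = edge-next (sub (here refl))
  walk-to-head a (b ∷ s) sub rewrite edge-next (sub (here refl)) = walk-to-head b s (λ m → sub (there m))

  walk-within : ∀ a s {b} → chain y (a ∷ s) ⊆ E → b ∈ a ∷ s →
    Σ ℕ λ k → k ≤ length s × iterate next a k ≡ b
  walk-within a s       sub (here refl) = 0 , z≤n , refl
  walk-within a (c ∷ s) sub (there b∈) with walk-within c s (λ m → sub (there m)) b∈
  ... | k , k≤s , c↦b =
    suc k , s≤s k≤s , trans (cong (λ x → iterate next x k) (edge-next (sub (here refl)))) c↦b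

  -- walk from a to the end of H, wrap around to its head y, then walk on to b
  reach : ∀ {a b} → a ∈ H → b ∈ H → Σ ℕ λ k → k ≤ length H + length H × iterate next a k ≡ b
  reach {a} a∈H b∈H with chain-suffix y a∈H | walk-within y ys chain⊆E b∈H
  ... | s , sub , s<H | k , k≤ys , y↦b =
    suc (length s) + k ,
    +-mono-≤ s<H (m≤n⇒m≤1+n k≤ys) ,
    trans (iterate-+ next a (suc (length s)) k)
          (trans (cong (λ x → iterate next x k) (walk-to-head a s (λ m → chain⊆E (sub m)))) y↦b)

module _ {A : Set} {P : A → Set} (P? : Decidable P) where

  count≡0⇒All∁ : ∀ {m} (xs : Vec A m) → count P? xs ≡ 0 → All (∁ P) (toList xs)
  count≡0⇒All∁ []       _     = []
  count≡0⇒All∁ (x ∷ xs) count≡0 with P? x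
  ... | no ¬px = ¬px ∷ count≡0⇒All∁ xs count≡0

  count≡suc⇒∃ : ∀ {m k} (xs : Vec A m) → count P? xs ≡ suc k → Σ (Fin m) λ i → P (lookup xs i)
  count≡suc⇒∃ (x ∷ xs) count≡ with P? x
  ... | yes px = zero , px
  ... | no _ with count≡suc⇒∃ xs count≡
  ...   | i , pxᵢ = suc i , pxᵢ

  count-[]≔-∁ : ∀ {m} (xs : Vec A m) i {v} → P (lookup xs i) → ¬ P v →
    suc (count P? (xs [ i ]≔ v)) ≡ count P? xs
  count-[]≔-∁ (x ∷ xs) zero    {v} px ¬pv with P? x | P? v
  ... | yes _  | no _  = refl
  ... | no ¬px | _     = ⊥-elim (¬px px)
  ... | _      | yes pv = ⊥-elim (¬pv pv)
  count-[]≔-∁ (x ∷ xs) (suc i) px ¬pv with P? x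
  ... | yes _ = cong suc (count-[]≔-∁ xs i px ¬pv)
  ... | no _  = count-[]≔-∁ xs i px ¬pv

  count-[]≔-∁∁ : ∀ {m} (xs : Vec A m) i {v} → ¬ P (lookup xs i) → ¬ P v →
    count P? (xs [ i ]≔ v) ≡ count P? xs
  count-[]≔-∁∁ (x ∷ xs) zero    {v} ¬px ¬pv with P? x | P? v
  ... | no _   | no _   = refl
  ... | yes px | _      = ⊥-elim (¬px px)
  ... | _      | yes pv = ⊥-elim (¬pv pv)
  count-[]≔-∁∁ (x ∷ xs) (suc i) ¬px ¬pv with P? x
  ... | yes _ = cong suc (count-[]≔-∁∁ xs i ¬px ¬pv)
  ... | no _  = count-[]≔-∁∁ xs i ¬px ¬pv

Gourd : Set
Gourd = Cell × Cell

cells : ∀ {m} → Vec Gourd m → List Cell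
cells gs = concatMap (λ g → proj₁ g ∷ proj₂ g ∷ []) (toList gs)

Occupies : Gourd → Cell → Cell → Set
Occupies w f g = (w ≡ (f , g)) ⊎ (w ≡ (g , f))

occupies-adj : ∀ {w f g} → Occupies w f g → Adj (proj₁ w) (proj₂ w) → Adj g f
occupies-adj (inj₁ refl) adj = Adj-sym adj
occupies-adj (inj₂ refl) adj = adj

length-cells : ∀ {m} (gs : Vec Gourd m) → length (cells gs) ≡ 2 * m
length-cells []               = refl
length-cells {suc m} (_ ∷ gs) = trans (cong (λ k → 2 + k) (length-cells gs)) (sym (*-suc 2 m))

∈-cells⁻ : ∀ {m} (gs : Vec Gourd m) {f} → f ∈ cells gs →
  Σ (Fin m) λ i → Σ Cell λ g → Occupies (lookup gs i) f g
∈-cells⁻ ((a , b) ∷ gs) (here refl)         = zero , b , inj₁ refl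
∈-cells⁻ ((a , b) ∷ gs) (there (here refl)) = zero , a , inj₂ refl
∈-cells⁻ (_ ∷ gs) (there (there f∈)) with ∈-cells⁻ gs f∈
... | i , g , occ = suc i , g , occ

∈-cells⁺ : ∀ {m} (gs : Vec Gourd m) i {f g} → Occupies (lookup gs i) f g →
  f ∈ cells gs × g ∈ cells gs
∈-cells⁺ (_ ∷ gs) zero    (inj₁ refl) = here refl , there (here refl)
∈-cells⁺ (_ ∷ gs) zero    (inj₂ refl) = there (here refl) , here refl
∈-cells⁺ (_ ∷ gs) (suc i) occ with ∈-cells⁺ gs i occ
... | f∈ , g∈ = there (there f∈) , there (there g∈)

All-[]≔ : ∀ {P : Gourd → Set} {m} (gs : Vec Gourd m) i {v} →
  All P (toList gs) → P v → All P (toList (gs [ i ]≔ v))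
All-[]≔ (_ ∷ gs) zero    (_ ∷ pgs)  pv = pv ∷ pgs
All-[]≔ (_ ∷ gs) (suc i) (pg ∷ pgs) pv = pg ∷ All-[]≔ gs i pgs pv

occupied-[]≔ : ∀ {m} (gs : Vec Gourd m) i {x y e v g} → lookup gs i ≡ (x , y) →
  x ∷ y ∷ e ∷ [] ↭ proj₁ v ∷ proj₂ v ∷ g ∷ [] →
  occupied (conf gs e) ↭ occupied (conf (gs [ i ]≔ v) g)
occupied-[]≔ (_ ∷ gs) zero {x} {y} {e} {v} {g} refl xye↭ = begin
  x ∷ y ∷ cells gs ++ e ∷ []               ↭⟨ ↭-prep x (↭-prep y (↭-sym (∷↭∷ʳ e (cells gs)))) ⟩
  (x ∷ y ∷ e ∷ []) ++ cells gs             ↭⟨ ++⁺ʳ (cells gs) xye↭ ⟩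
  (proj₁ v ∷ proj₂ v ∷ g ∷ []) ++ cells gs ↭⟨ ↭-prep _ (↭-prep _ (∷↭∷ʳ g (cells gs))) ⟩
  proj₁ v ∷ proj₂ v ∷ cells gs ++ g ∷ []   ∎
  where open PermutationReasoning
occupied-[]≔ ((a , b) ∷ gs) (suc i) eq xye↭ = ↭-prep a (↭-prep b (occupied-[]≔ gs i eq xye↭))

ValidConfig-[]≔ : ∀ {B m} {gs : Vec Gourd m} {e} i {x y v g} → lookup gs i ≡ (x , y) →
  Adj (proj₁ v) (proj₂ v) → x ∷ y ∷ e ∷ [] ↭ proj₁ v ∷ proj₂ v ∷ g ∷ [] →
  ValidConfig B (conf gs e) → ValidConfig B (conf (gs [ i ]≔ v) g)
ValidConfig-[]≔ {gs = gs} i eq adj xye↭ (adjs , inB , u) =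
  All-[]≔ gs i adjs adj , All-resp-↭ occ↭ inB , unique-resp-↭ occ↭ u
  where occ↭ = occupied-[]≔ gs i eq xye↭

Move-valid : ∀ {B m} {c c' : Config m} → Move c c' → ValidConfig B c → ValidConfig B c'
Move-valid (stA i eq (_ , d' , _ , e≡ , _)) =
  ValidConfig-[]≔ i eq (d' , e≡) (↭-trans (↭-swap _ _ ↭-refl) (↭-prep _ (↭-swap _ _ ↭-refl)))
Move-valid (stB i eq (_ , d' , _ , e≡ , _)) =
  ValidConfig-[]≔ i eq (Adj-sym (d' , e≡)) (↭-sym (∷↭∷ʳ _ (_ ∷ _ ∷ [])))
Move-valid (pvA i eq ex ey) = ValidConfig-[]≔ i eq (Adj-sym ex) (↭-prep _ (↭-swap _ _ ↭-refl))
Move-valid (pvB i eq ex ey) =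
  ValidConfig-[]≔ i eq ey
    (↭-trans (↭-swap _ _ ↭-refl) (↭-trans (↭-prep _ (↭-swap _ _ ↭-refl)) (↭-swap _ _ ↭-refl)))

moveOnto : ∀ {m} {gs : Vec Gourd m} {e} i {f g} →
  Occupies (lookup gs i) f g → Adj g f → Adj e f → g ≢ e →
  Σ Gourd λ v → Occupies v e f × Move (conf gs e) (conf (gs [ i ]≔ v) g)
moveOnto {e = e} i {f} (inj₁ eq) gf ef g≢e with slideTurnOrPivot gf (Adj-sym ef) g≢e
... | inj₁ st         = (e , f) , inj₁ refl , stB i eq st
... | inj₂ (eg , ef') = (f , e) , inj₂ refl , pvA i eq ef' eg
moveOnto {e = e} i {f} (inj₂ eq) gf ef g≢e with slideTurnOrPivot gf (Adj-sym ef) g≢e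
... | inj₁ st         = (f , e) , inj₂ refl , stA i eq st
... | inj₂ (eg , ef') = (e , f) , inj₁ refl , pvB i eq eg ef'

_++ₘ_ : ∀ {m k k'} {c c' c'' : Config m} → Moves k c c' → Moves k' c' c'' → Moves (k + k') c c''
done        ++ₘ mvs' = mvs'
(mv ∷ₘ mvs) ++ₘ mvs' = mv ∷ₘ (mvs ++ₘ mvs')

quadratic-bound : ∀ n → n * (suc (2 * n) + suc (2 * n)) ≤ 6 * (n * n)
quadratic-bound zero      = z≤n
quadratic-bound n@(suc _) = begin
  n * (suc (2 * n) + suc (2 * n)) ≡⟨ expand n ⟩
  2 * n + 4 * (n * n)             ≤⟨ +-monoˡ-≤ (4 * (n * n)) (*-monoʳ-≤ 2 (m≤m*n n n)) ⟩
  2 * (n * n) + 4 * (n * n)       ≡⟨ collect n ⟩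
  6 * (n * n)                     ∎
  where
  open ≤-Reasoning
  expand : ∀ n → n * (suc (2 * n) + suc (2 * n)) ≡ 2 * n + 4 * (n * n)
  expand = solve-∀
  collect : ∀ n → 2 * (n * n) + 4 * (n * n) ≡ 6 * (n * n)
  collect = solve-∀

module Alignment {n : ℕ} {B : Board} {y : Cell} {ys : List Cell}
  (B-unique : Unique B) (B-length : length B ≡ suc (2 * n)) (H↭B : y ∷ ys ↭ B)
  (H-adj : All (λ p → Adj (proj₁ p) (proj₂ p)) (cycEdges (y ∷ ys))) where

  open CyclicSuccessor y ys (unique-resp-↭ (↭-sym H↭B) B-unique)

  Aligned : Gourd → Set
  Aligned w = ConsecutiveOn H (proj₁ w) (proj₂ w)

  aligned? : Decidable Aligned
  aligned? (a , b) = ((a , b) ∈? E) ⊎-dec ((b , a) ∈? E)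
    where open import Data.List.Membership.DecPropositional (≡-dec _≟_ _≟_) using (_∈?_)

  misaligned : Vec Gourd n → ℕ
  misaligned = count (∁? aligned?)

  Valid : Config n → Set
  Valid = ValidConfig B

  ReachesWithin : ℕ → ℕ → Config n → Set
  ReachesWithin k m c = Σ (Config n) λ c' → Σ ℕ λ j →
    j ≤ k × Moves j c c' × Valid c' × misaligned (gourds c') ≡ m

  H-length : length H ≡ suc (2 * n)
  H-length = trans (↭-length H↭B) B-length

  board-occupied : ∀ {gs e} → Valid (conf gs e) → B ⊆ occupied (conf gs e)
  board-occupied {gs} {e} (_ , inB , u) =
    unique-⊆-length⇒⊇ _≟_ u (All.lookup inB) (≤-reflexive B≡occupied)
    where
    B≡occupied : length B ≡ length (occupied (conf gs e))
    B≡occupied = trans B-length (sym (trans (length-++ (cells gs))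
                   (trans (+-comm (length (cells gs)) 1) (cong suc (length-cells gs)))))

  cell≢empty : ∀ {gs e f} → Valid (conf gs e) → f ∈ cells gs → f ≢ e
  cell≢empty {gs} {e} (_ , _ , u) f∈ refl =
    Unique[x∷xs]⇒x∉xs (unique-resp-↭ (↭-sym (∷↭∷ʳ e (cells gs))) u) f∈

  occupied⊆H : ∀ {c} → Valid c → occupied c ⊆ H
  occupied⊆H (_ , inB , _) f∈ = ∈-resp-↭ (↭-sym H↭B) (All.lookup inB f∈)

  empty∈H : ∀ {gs e} → Valid (conf gs e) → e ∈ H
  empty∈H {gs} V = occupied⊆H V (∈-++⁺ʳ (cells gs) (here refl))

  occupant : ∀ {gs e f} → Valid (conf gs e) → f ∈ B → f ≢ e →
    Σ (Fin n) λ i → Σ Cell λ g → Occupies (lookup gs i) f g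
  occupant {gs} V f∈B f≢e with ∈-++⁻ (cells gs) (board-occupied V f∈B)
  ... | inj₁ f∈cells    = ∈-cells⁻ gs f∈cells
  ... | inj₂ (here f≡e) = ⊥-elim (f≢e f≡e)

  successor-occupant : ∀ {gs e} → Valid (conf gs e) →
    Σ (Fin n) λ i → Σ Cell λ g → Occupies (lookup gs i) (next e) g
  successor-occupant {e = e} V = occupant V (∈-resp-↭ H↭B (next-∈ (empty∈H V))) next≢e
    where
    next≢e : next e ≢ e
    next≢e next≡e = Adj-irrefl (subst (Adj e) next≡e (All.lookup H-adj (next-edge (empty∈H V))))

  misaligned-fixed : ∀ gs i {v m} → ¬ Aligned (lookup gs i) → Aligned v →
    misaligned gs ≡ suc m → misaligned (gs [ i ]≔ v) ≡ m
  misaligned-fixed gs i ¬alᵢ alᵥ count≡ =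
    suc-injective (trans (count-[]≔-∁ (∁? aligned?) gs i ¬alᵢ (λ ¬alᵥ → ¬alᵥ alᵥ)) count≡)

  misaligned-kept : ∀ gs i {v m} → Aligned (lookup gs i) → Aligned v →
    misaligned gs ≡ m → misaligned (gs [ i ]≔ v) ≡ m
  misaligned-kept gs i alᵢ alᵥ count≡ =
    trans (count-[]≔-∁∁ (∁? aligned?) gs i (λ ¬alᵢ → ¬alᵢ alᵢ) (λ ¬alᵥ → ¬alᵥ alᵥ)) count≡

  occupies-edge : ∀ {v e f} → Occupies v e f → (e , f) ∈ E → Aligned v
  occupies-edge (inj₁ refl) ef∈ = inj₁ ef∈
  occupies-edge (inj₂ refl) ef∈ = inj₂ ef∈

  aligned-successor : ∀ {w e f g} → Occupies w f g → Aligned w → (e , f) ∈ E → g ≢ e → g ≡ next f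
  aligned-successor (inj₁ refl) (inj₁ fg∈) _   _   = sym (edge-next fg∈)
  aligned-successor (inj₁ refl) (inj₂ gf∈) ef∈ g≢e = ⊥-elim (g≢e (edge-injectiveˡ gf∈ ef∈))
  aligned-successor (inj₂ refl) (inj₁ gf∈) ef∈ g≢e = ⊥-elim (g≢e (edge-injectiveˡ gf∈ ef∈))
  aligned-successor (inj₂ refl) (inj₂ fg∈) _   _   = sym (edge-next fg∈)

  fillEdge : ∀ {gs e} → Valid (conf gs e) → ∀ i {g} → Occupies (lookup gs i) (next e) g →
    Σ Gourd λ v → Aligned v × Move (conf gs e) (conf (gs [ i ]≔ v) g) × Valid (conf (gs [ i ]≔ v) g)
  fillEdge {gs} {e} V@(adjs , _) i occ =
    let v , occ' , mv = moveOnto i occ (occupies-adj occ (lookup⁺ (toList⁻ adjs) i)) (All.lookup H-adj e↦)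
                                   (cell≢empty V (proj₂ (∈-cells⁺ gs i occ)))
    in v , occupies-edge occ' e↦ , mv , Move-valid mv V
    where
    e↦ : (e , next e) ∈ E
    e↦ = next-edge (empty∈H V)

  -- Each move aligns some misaligned gourd or brings the empty cell two steps closer to gourd j.
  alignOne : ∀ k {m gs e} → Valid (conf gs e) → misaligned gs ≡ suc m →
    ∀ j → ¬ Aligned (lookup gs j) → iterate next e k ≡ proj₁ (lookup gs j) →
    ReachesWithin k m (conf gs e)
  alignOne zero {gs = gs} V _ j _ e≡ =
    ⊥-elim (cell≢empty V (proj₁ (∈-cells⁺ gs j (inj₁ refl))) (sym e≡))
  alignOne (suc zero) {gs = gs} V count≡ j ¬alⱼ next≡ =
    let v , alᵥ , mv , V' = fillEdge V j (inj₁ (cong (_, proj₂ (lookup gs j)) (sym next≡)))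
    in _ , 1 , ≤-refl , mv ∷ₘ done , V' , misaligned-fixed gs j ¬alⱼ alᵥ count≡
  alignOne (suc (suc k)) {gs = gs} {e} V count≡ j ¬alⱼ path with successor-occupant V
  ... | i , g , occ with fillEdge V i occ | aligned? (lookup gs i)
  ...   | v , alᵥ , mv , V' | no ¬alᵢ =
    _ , 1 , s≤s z≤n , mv ∷ₘ done , V' , misaligned-fixed gs i ¬alᵢ alᵥ count≡
  ...   | v , alᵥ , mv , V' | yes alᵢ =
    let c' , k' , k'≤k , mvs , V'' , count'≡ =
          alignOne k V' (misaligned-kept gs i alᵢ alᵥ count≡) j (subst (¬_ ∘ Aligned) (sym jᵢ) ¬alⱼ)
            (trans (cong (λ x → iterate next x k) g≡) (trans path (cong proj₁ (sym jᵢ))))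
    in c' , suc k' , s≤s (m≤n⇒m≤1+n k'≤k) , mv ∷ₘ mvs , V'' , count'≡
    where
    j≢i : j ≢ i
    j≢i refl = ¬alⱼ alᵢ
    jᵢ : lookup (gs [ i ]≔ v) j ≡ lookup gs j
    jᵢ = lookup∘update′ j≢i gs v
    g≡ : g ≡ next (next e)
    g≡ = aligned-successor occ alᵢ (next-edge (empty∈H V)) (cell≢empty V (proj₂ (∈-cells⁺ gs i occ)))

  alignAll : ∀ m {gs e} → Valid (conf gs e) → misaligned gs ≡ m →
    ReachesWithin (m * (length H + length H)) 0 (conf gs e)
  alignAll zero    V count≡ = _ , 0 , z≤n , done , V , count≡
  alignAll (suc m) {gs} V count≡ =
    let j , ¬alⱼ = count≡suc⇒∃ (∁? aligned?) gs count≡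
        k , k≤ , path =
          reach (empty∈H V) (occupied⊆H V (∈-++⁺ˡ (proj₁ (∈-cells⁺ gs j (inj₁ refl)))))
        _ , k₁ , k₁≤k , mvs₁ , V' , count'≡ = alignOne k V count≡ j ¬alⱼ path
        c' , k₂ , k₂≤ , mvs₂ , V'' , count''≡ = alignAll m V' count'≡
    in c' , k₁ + k₂ , +-mono-≤ (≤-trans k₁≤k k≤) k₂≤ , mvs₁ ++ₘ mvs₂ , V'' , count''≡

  align : ∀ {gs e} → Valid (conf gs e) → Σ (Config n) λ c' → Σ ℕ λ k →
    k ≤ 6 * (n * n) × Moves k (conf gs e) c' × AlignedWith H c'
  align {gs} V with alignAll (misaligned gs) V refl
  ... | c' , k , k≤ , mvs , _ , count≡0 =
    c' , k , ≤-trans k≤ bound , mvs ,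
    All.map (decidable-stable (aligned? _)) (count≡0⇒All∁ (∁? aligned?) (gourds c') count≡0)
    where
    open ≤-Reasoning
    bound : misaligned gs * (length H + length H) ≤ 6 * (n * n)
    bound = begin
      misaligned gs * (length H + length H) ≤⟨ *-monoˡ-≤ _ (count≤n (∁? aligned?) gs) ⟩
      n * (length H + length H)             ≡⟨ cong (λ h → n * (h + h)) H-length ⟩
      n * (suc (2 * n) + suc (2 * n))       ≤⟨ quadratic-bound n ⟩
      6 * (n * n)                           ∎

lemma2 : Σ ℕ λ C → ∀ (n : ℕ) (B : Board) (H : List Cell) (c : Config n) →
    Proper n B → HamiltonianCycle B H → ValidConfig B c →
    Σ (Config n) λ c' → Σ ℕ λ k → (k ≤ C * (n * n)) × Moves k c c' × AlignedWith H c'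
lemma2 = 6 , λ where
  n B []       c          (_ , B-length , _)        (H↭B , _)     _ →
    ⊥-elim (0≢1+n (trans (↭-length H↭B) B-length))
  n B (y ∷ ys) (conf gs e) (B-unique , B-length , _) (H↭B , H-adj) V →
    Alignment.align B-unique B-length H↭B H-adj V
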